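{- (Generation.) (1) If $x:\langle\Gamma\vdash U\rangle$, then $\Gamma=(x:V)$ for some $V$ with $V\sqsubseteq U$. (2) If $M\,x:\langle\Gamma,x:U\vdash V\rangle$ and $x\notin FV(M)$, then $V=\omega$ or $V=\sqcap_{i=1}^k T_i$ with $k\ge1$ and $M:\langle\Gamma\vdash U\to T_i\rangle$ for all $1\le i\le k$. (3) If $\lambda x.M:\langle\Gamma\vdash U\rangle$ and $x\in FV(M)$, then $U=\omega$ or $U=\sqcap_{i=1}^k(V_i\to T_i)$ with $k\ge1$ and $M:\langle\Gamma,x:V_i\vdash T_i\rangle$ for all $1\le i\le k$. (4) If $\lambda x.M:\langle\Gamma\vdash U\rangle$ and $x\notin FV(M)$, then $U=\omega$ or $U=\sqcap_{i=1}^k(V_i\to T_i)$ with $k\ge1$ and $M:\langle\Gamma\vdash T_i\rangle$ for all $1\le i\le k$.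
   Context: Terms: $\mathcal V$ is a denumerably infinite set of variables; $\mathcal M$ is the set of untyped $\lambda$-terms $M::=x\mid \lambda x.M\mid MM$ taken modulo $\alpha$-conversion; $FV(M)$ is the set of free variables. Types: $\mathcal A$ is a denumerably infinite set of atomic types; $\mathbb T::=a\mid \mathbb U\to\mathbb T$ ($a\in\mathcal A$) and $\mathbb U::=\omega\mid \mathbb U\sqcap\mathbb U\mid \mathbb T$; types are quotiented by commutativity, associativity and idempotence of $\sqcap$ and by $\omega\sqcap U=U$. $T,T_i$ range over $\mathbb T$, $U,V,V_i$ over $\mathbb U$; $\sqcap_{i=1}^kT_i$ denotes $T_1\sqcap\dots\sqcap T_k$. Environments: a type environment is a finite set $(x_i:U_i)_n$ of declarations with pairwise distinct variables; $dom$ is its set of variables; $\Gamma,x:U$ requires $x\notin dom(\Gamma)$; $env^M_\omega$ assigns $\omega$ to each variable of $FV(M)$ and nothing else; if $\Gamma_1=(x_i:U_i)_n,(y_j:V_j)_m$ and $\Gamma_2=(x_i:U'_i)_n,(z_k:W_k)_l$ with the $y_j$, $z_k$ all distinct, then $\Gamma_1\sqcap\Gamma_2=(x_i:U_i\sqcap U'_i)_n,(y_j:V_j)_m,(z_k:W_k)_l$. Subtyping: $\sqsubseteq$ (on types, on environments, and on typings $\langle\Gamma\vdash U\rangle$) is the least relation closed under: $\Phi\sqsubseteq\Phi$; transitivity; $U_1\sqcap U_2\sqsubseteq U_1$; if $U_1\sqsubseteq V_1$ and $U_2\sqsubseteq V_2$ then $U_1\sqcap U_2\sqsubseteq V_1\sqcap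 V_2$; if $U_2\sqsubseteq U_1$ and $T_1\sqsubseteq T_2$ then $U_1\to T_1\sqsubseteq U_2\to T_2$; if $U_1\sqsubseteq U_2$ and $x\notin dom(\Gamma)$ then $\Gamma,x:U_1\sqsubseteq\Gamma,x:U_2$; if $U_1\sqsubseteq U_2$ and $\Gamma_2\sqsubseteq\Gamma_1$ then $\langle\Gamma_1\vdash U_1\rangle\sqsubseteq\langle\Gamma_2\vdash U_2\rangle$. Typing rules for $M:\langle\Gamma\vdash U\rangle$: (ax) $x:\langle x:T\vdash T\rangle$ for $T\in\mathbb T$; ($\omega$) $M:\langle env^M_\omega\vdash\omega\rangle$; ($\to_i$) from $M:\langle\Gamma,x:U\vdash T\rangle$ infer $\lambda x.M:\langle\Gamma\vdash U\to T\rangle$; ($\to'_i$) from $M:\langle\Gamma\vdash T\rangle$ and $x\notin dom(\Gamma)$ infer $\lambda x.M:\langle\Gamma\vdash\omega\to T\rangle$; ($\to_e$) from $M_1:\langle\Gamma_1\vdash U\to T\rangle$ and $M_2:\langle\Gamma_2\vdash U\rangle$ infer $M_1M_2:\langle\Gamma_1\sqcap\Gamma_2\vdash T\rangle$; ($\sqcap_i$) from $M:\langle\Gamma\vdash U_1\rangle$ and $M:\langle\Gamma\vdash U_2\rangle$ infer $M:\langle\Gamma\vdash U_1\sqcap U_2\rangle$; ($\sqsubseteq$) from $M:\langle\Gamma\vdash U\rangle$ and $\langle\Gamma\vdash U\rangle\sqsubseteq\langle\Gamma'\vdash U'\rangle$ infer $M:\langle\Gamma'\vdash U'\rangle$. 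-}

module Defs where

open import Data.Nat using (ℕ; _≟_)
open import Data.Fin using (Fin; zero; suc)
open import Data.Bool using (if_then_else_)
open import Data.Maybe using (Maybe; just; nothing)
open import Data.List using (List; []; _∷_; _++_; filter)
open import Data.List.Membership.DecPropositional _≟_ using (_∈?_)
open import Relation.Nullary using (¬?)
open import Relation.Nullary.Decidable using (⌊_⌋)
open import Relation.Binary.PropositionalEquality using (_≡_)

Var : Set
Var = ℕ

data Term : Set where
  var : Var → Term
  lam : Var → Term → Term
  app : Term → Term → Term

fv : Term → List Var
fv (var x)   = x ∷ []
fv (lam x M) = filter (λ y → ¬? (y ≟ x)) (fv M)
fv (app M N) = fv M ++ fv N

infixr 7 _⇒_
infixl 8 _⊓_

data 𝕋 : Set
data 𝕌 : Set

data 𝕋 where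
  atom : ℕ → 𝕋
  _⇒_  : 𝕌 → 𝕋 → 𝕋

data 𝕌 where
  ω   : 𝕌
  _⊓_ : 𝕌 → 𝕌 → 𝕌
  ⌜_⌝ : 𝕋 → 𝕌

-- The quotient of types: the congruence generated by commutativity,
-- associativity, idempotence of ⊓ and ω ⊓ U = U.
-- (Equality of 𝕋-types T, T' is ⌜ T ⌝ ≃ ⌜ T' ⌝.)
infix 4 _≃_
data _≃_ : 𝕌 → 𝕌 → Set where
  ≃-refl  : ∀ {U} → U ≃ U
  ≃-sym   : ∀ {U V} → U ≃ V → V ≃ U
  ≃-trans : ∀ {U V W} → U ≃ V → V ≃ W → U ≃ W
  ≃-comm  : ∀ {U V} → U ⊓ V ≃ V ⊓ U
  ≃-assoc : ∀ {U V W} → (U ⊓ V) ⊓ W ≃ U ⊓ (V ⊓ W)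
  ≃-idem  : ∀ {U} → U ⊓ U ≃ U
  ≃-unit  : ∀ {U} → ω ⊓ U ≃ U
  ≃-⊓     : ∀ {U U' V V'} → U ≃ U' → V ≃ V' → U ⊓ V ≃ U' ⊓ V'
  ≃-⇒     : ∀ {U U' T T'} → U ≃ U' → ⌜ T ⌝ ≃ ⌜ T' ⌝ → ⌜ U ⇒ T ⌝ ≃ ⌜ U' ⇒ T' ⌝

-- ⊓_{i=1}^k U_i  (for k = 0 this is ω; the statements only use k ≥ 1,
-- where the trailing ω is absorbed by ω ⊓ U = U).
⨅ : ∀ {k} → (Fin k → 𝕌) → 𝕌
⨅ {ℕ.zero}  f = ω
⨅ {ℕ.suc k} f = f zero ⊓ ⨅ (λ i → f (suc i))

-- Type environments: partial maps from variables to 𝕌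
-- (dom Γ = { x | Γ x ≢ nothing }).

Env : Set
Env = Var → Maybe 𝕌

_∉dom_ : Var → Env → Set
x ∉dom Γ = Γ x ≡ nothing

∅ : Env
∅ _ = nothing

[_∶_] : Var → 𝕌 → Env
[ x ∶ U ] y = if ⌊ y ≟ x ⌋ then just U else nothing

-- Γ , x : U   (only used under the side condition x ∉dom Γ)
_,_∶_ : Env → Var → 𝕌 → Env
(Γ , x ∶ U) y = if ⌊ y ≟ x ⌋ then just U else Γ y

envω : Term → Env
envω M y = if ⌊ y ∈? fv M ⌋ then just ω else nothing

_⊓ₑ_ : Env → Env → Env
(Γ₁ ⊓ₑ Γ₂) y with Γ₁ y | Γ₂ y
... | just U  | just U' = just (U ⊓ U')
... | just U  | nothing = just U
... | nothing | just U' = just U'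
... | nothing | nothing = nothing

data _≃ₘ_ : Maybe 𝕌 → Maybe 𝕌 → Set where
  nothing≃ : nothing ≃ₘ nothing
  just≃    : ∀ {U V} → U ≃ V → just U ≃ₘ just V

infix 4 _≈ₑ_
_≈ₑ_ : Env → Env → Set
Γ ≈ₑ Δ = ∀ y → Γ y ≃ₘ Δ y

infix 4 _⊑_ _⊑ₑ_ _⊑ₜ_
data _⊑_ : 𝕌 → 𝕌 → Set where
  ⊑-refl  : ∀ {U V} → U ≃ V → U ⊑ V
  ⊑-trans : ∀ {U V W} → U ⊑ V → V ⊑ W → U ⊑ W
  ⊑-⊓ₗ    : ∀ {U₁ U₂} → U₁ ⊓ U₂ ⊑ U₁
  ⊑-⊓     : ∀ {U₁ U₂ V₁ V₂} → U₁ ⊑ V₁ → U₂ ⊑ V₂ → U₁ ⊓ U₂ ⊑ V₁ ⊓ V₂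
  ⊑-⇒     : ∀ {U₁ U₂ T₁ T₂} → U₂ ⊑ U₁ → ⌜ T₁ ⌝ ⊑ ⌜ T₂ ⌝ →
            ⌜ U₁ ⇒ T₁ ⌝ ⊑ ⌜ U₂ ⇒ T₂ ⌝

data _⊑ₑ_ : Env → Env → Set where
  ⊑ₑ-refl  : ∀ {Γ Δ} → Γ ≈ₑ Δ → Γ ⊑ₑ Δ
  ⊑ₑ-trans : ∀ {Γ Δ Θ} → Γ ⊑ₑ Δ → Δ ⊑ₑ Θ → Γ ⊑ₑ Θ
  ⊑ₑ-ext   : ∀ {Γ x U₁ U₂} → x ∉dom Γ → U₁ ⊑ U₂ →
             (Γ , x ∶ U₁) ⊑ₑ (Γ , x ∶ U₂)

record Typing : Set where
  constructor ⟨_⊢_⟩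
  field
    ctx : Env
    ty  : 𝕌

data _⊑ₜ_ : Typing → Typing → Set where
  ⊑ₜ-refl  : ∀ {Γ Δ U V} → Γ ≈ₑ Δ → U ≃ V → ⟨ Γ ⊢ U ⟩ ⊑ₜ ⟨ Δ ⊢ V ⟩
  ⊑ₜ-trans : ∀ {Φ Ψ Χ} → Φ ⊑ₜ Ψ → Ψ ⊑ₜ Χ → Φ ⊑ₜ Χ
  ⊑ₜ-⟨⟩    : ∀ {Γ₁ Γ₂ U₁ U₂} → U₁ ⊑ U₂ → Γ₂ ⊑ₑ Γ₁ →
             ⟨ Γ₁ ⊢ U₁ ⟩ ⊑ₜ ⟨ Γ₂ ⊢ U₂ ⟩

infix 3 _∶⟨_⊢_⟩
data _∶⟨_⊢_⟩ : Term → Env → 𝕌 → Set where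
  ax   : ∀ {x T} → var x ∶⟨ [ x ∶ ⌜ T ⌝ ] ⊢ ⌜ T ⌝ ⟩
  ω-r  : ∀ {M} → M ∶⟨ envω M ⊢ ω ⟩
  →i   : ∀ {Γ x U T M} → x ∉dom Γ → M ∶⟨ Γ , x ∶ U ⊢ ⌜ T ⌝ ⟩ →
         lam x M ∶⟨ Γ ⊢ ⌜ U ⇒ T ⌝ ⟩
  →'i  : ∀ {Γ x T M} → x ∉dom Γ → M ∶⟨ Γ ⊢ ⌜ T ⌝ ⟩ →
         lam x M ∶⟨ Γ ⊢ ⌜ ω ⇒ T ⌝ ⟩
  →e   : ∀ {Γ₁ Γ₂ U T M₁ M₂} → M₁ ∶⟨ Γ₁ ⊢ ⌜ U ⇒ T ⌝ ⟩ → M₂ ∶⟨ Γ₂ ⊢ U ⟩ →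
         app M₁ M₂ ∶⟨ Γ₁ ⊓ₑ Γ₂ ⊢ ⌜ T ⌝ ⟩
  ⊓i   : ∀ {Γ U₁ U₂ M} → M ∶⟨ Γ ⊢ U₁ ⟩ → M ∶⟨ Γ ⊢ U₂ ⟩ → M ∶⟨ Γ ⊢ U₁ ⊓ U₂ ⟩
  ⊑r   : ∀ {Γ Γ' U U' M} → M ∶⟨ Γ ⊢ U ⟩ → ⟨ Γ ⊢ U ⟩ ⊑ₜ ⟨ Γ' ⊢ U' ⟩ →
         M ∶⟨ Γ' ⊢ U' ⟩

module Submission where

-- Apart from (ω), (⊓i) and subsumption (⊑r), every typing rule is
-- syntax-directed, so each part is proved by induction on the typing
-- derivation with an invariant that survives (⊓i) and (⊑r).  For parts
-- (2)-(4) the invariant says that every *component* of the derived type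
-- (a 𝕋-type occurring under ω/⊓) satisfies some property P; it is
-- generalised over all environments above the given one, so that
-- subsumption on the environment side is absorbed too.  To survive
-- subsumption on the type side we show that ⊑ coincides with a
-- syntax-directed relation ≤ᵁ, in which every component of the larger type
-- lies above some component of the smaller one.  Finally, a type all of
-- whose components satisfy P is ≃ to ω or to the finite intersection of
-- those components, which yields the ⨅-shape required by the statement.

open import Defs
open import Data.Nat using (ℕ; _≤_; _≟_; s≤s; z≤n)
open import Data.Fin using (Fin)
open import Data.Product using (Σ; _×_; ∃-syntax; _,_; proj₁; proj₂)
open import Data.Sum using (_⊎_; inj₁; inj₂)
open import Data.Empty using (⊥-elim)
open import Data.Bool using (if_then_else_)
open import Data.Maybe using (Maybe; just; nothing)
open import Data.List using (List; []; _∷_; _++_; lookup)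
open import Data.List.Relation.Unary.Any using (here)
open import Data.List.Membership.Propositional using (_∈_; _∉_)
open import Data.List.Membership.Propositional.Properties
  using (∈-++⁻; ∈-++⁺ˡ; ∈-++⁺ʳ; ∈-filter⁻; ∈-filter⁺; ∈-lookup)
open import Data.List.Membership.DecPropositional _≟_ using (_∈?_)
open import Relation.Nullary using (yes; no; ¬_; ¬?)
open import Relation.Nullary.Decidable using (⌊_⌋)
open import Relation.Binary.PropositionalEquality
  using (_≡_; _≢_; refl; sym; trans; cong; subst; subst₂)

-- Γ [ x ↦ m ] overrides the entry of x.  Both Γ , x ∶ U (definitionally,
-- with m = just U) and the removal of x (m = nothing) are instances.
_[_↦_] : Env → Var → Maybe 𝕌 → Env
(Γ [ x ↦ m ]) y = if ⌊ y ≟ x ⌋ then m else Γ y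

infix 4 _≐_
_≐_ : Env → Env → Set
Γ ≐ Δ = ∀ y → Γ y ≡ Δ y

upd-here : ∀ Γ x m → (Γ [ x ↦ m ]) x ≡ m
upd-here Γ x m with x ≟ x
... | yes _   = refl
... | no x≢x = ⊥-elim (x≢x refl)

upd-there : ∀ Γ x m {y} → y ≢ x → (Γ [ x ↦ m ]) y ≡ Γ y
upd-there Γ x m {y} y≢x with y ≟ x
... | yes y≡x = ⊥-elim (y≢x y≡x)
... | no _    = refl

upd-shadow : ∀ Γ x m n → (Γ [ x ↦ m ]) [ x ↦ n ] ≐ Γ [ x ↦ n ]
upd-shadow Γ x m n y with y ≟ x
... | yes _ = refl
... | no _  = refl

upd-comm : ∀ Γ {x z} m n → x ≢ z → (Γ [ x ↦ m ]) [ z ↦ n ] ≐ (Γ [ z ↦ n ]) [ x ↦ m ]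
upd-comm Γ {x} {z} m n x≢z y with y ≟ x | y ≟ z
... | yes y≡x | yes y≡z = ⊥-elim (x≢z (trans (sym y≡x) y≡z))
... | yes _   | no _    = refl
... | no _    | yes _   = refl
... | no _    | no _    = refl

upd-id : ∀ Γ x {m} → Γ x ≡ m → Γ [ x ↦ m ] ≐ Γ
upd-id Γ x Γx y with y ≟ x
... | yes refl = sym Γx
... | no _     = refl

,-∈dom : ∀ Γ x U → ¬ (x ∉dom (Γ , x ∶ U))
,-∈dom Γ x U x∉ with trans (sym (upd-here Γ x (just U))) x∉
... | ()

envω-∈ : ∀ M {y} → y ∈ fv M → envω M y ≡ just ω
envω-∈ M {y} y∈M with y ∈? fv M
... | yes _   = refl
... | no y∉M = ⊥-elim (y∉M y∈M)

envω-∉ : ∀ M {y} → y ∉ fv M → envω M y ≡ nothing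
envω-∉ M {y} y∉M with y ∈? fv M
... | yes y∈M = ⊥-elim (y∉M y∈M)
... | no _    = refl

⊓ₑ-nothingˡ : ∀ Γ₁ Γ₂ y → Γ₁ y ≡ nothing → (Γ₁ ⊓ₑ Γ₂) y ≡ Γ₂ y
⊓ₑ-nothingˡ Γ₁ Γ₂ y e with Γ₁ y | Γ₂ y
⊓ₑ-nothingˡ Γ₁ Γ₂ y () | just _ | _
⊓ₑ-nothingˡ Γ₁ Γ₂ y e | nothing | just _  = refl
⊓ₑ-nothingˡ Γ₁ Γ₂ y e | nothing | nothing = refl

⊓ₑ-nothingʳ : ∀ Γ₁ Γ₂ y → Γ₂ y ≡ nothing → (Γ₁ ⊓ₑ Γ₂) y ≡ Γ₁ y
⊓ₑ-nothingʳ Γ₁ Γ₂ y e with Γ₁ y | Γ₂ y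
⊓ₑ-nothingʳ Γ₁ Γ₂ y () | _ | just _
⊓ₑ-nothingʳ Γ₁ Γ₂ y e | just _  | nothing = refl
⊓ₑ-nothingʳ Γ₁ Γ₂ y e | nothing | nothing = refl

⊓ₑ-nothing⁻ : ∀ Γ₁ Γ₂ y → (Γ₁ ⊓ₑ Γ₂) y ≡ nothing → (Γ₁ y ≡ nothing) × (Γ₂ y ≡ nothing)
⊓ₑ-nothing⁻ Γ₁ Γ₂ y e with Γ₁ y | Γ₂ y
⊓ₑ-nothing⁻ Γ₁ Γ₂ y () | just _  | just _
⊓ₑ-nothing⁻ Γ₁ Γ₂ y () | just _  | nothing
⊓ₑ-nothing⁻ Γ₁ Γ₂ y () | nothing | just _
⊓ₑ-nothing⁻ Γ₁ Γ₂ y e  | nothing | nothing = refl , refl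

⊑-id : ∀ {U} → U ⊑ U
⊑-id = ⊑-refl ≃-refl

≃ₘ-refl : ∀ m → m ≃ₘ m
≃ₘ-refl nothing  = nothing≃
≃ₘ-refl (just U) = just≃ ≃-refl

⊑ₑ-id : ∀ {Γ} → Γ ⊑ₑ Γ
⊑ₑ-id {Γ} = ⊑ₑ-refl (λ y → ≃ₘ-refl (Γ y))

≐⇒⊑ₑ : ∀ {Γ Δ} → Γ ≐ Δ → Γ ⊑ₑ Δ
≐⇒⊑ₑ {Γ} Γ≐Δ = ⊑ₑ-refl (λ y → subst (Γ y ≃ₘ_) (Γ≐Δ y) (≃ₘ-refl (Γ y)))

upd-mono : ∀ x m {Γ Δ} → Γ ⊑ₑ Δ → Γ [ x ↦ m ] ⊑ₑ Δ [ x ↦ m ]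
upd-mono x m {Γ} {Δ} (⊑ₑ-refl Γ≈Δ) = ⊑ₑ-refl updated
  where
  updated : (Γ [ x ↦ m ]) ≈ₑ (Δ [ x ↦ m ])
  updated y with y ≟ x
  ... | yes _ = ≃ₘ-refl m
  ... | no _  = Γ≈Δ y
upd-mono x m (⊑ₑ-trans p q) = ⊑ₑ-trans (upd-mono x m p) (upd-mono x m q)
upd-mono x m (⊑ₑ-ext {Θ} {z} {U₁} {U₂} z∉Θ U₁⊑U₂) with z ≟ x
... | yes refl = ≐⇒⊑ₑ λ y →
      trans (upd-shadow Θ z (just U₁) m y) (sym (upd-shadow Θ z (just U₂) m y))
... | no z≢x = ⊑ₑ-trans (≐⇒⊑ₑ (upd-comm Θ (just U₁) m z≢x))
                 (⊑ₑ-trans (⊑ₑ-ext (trans (upd-there Θ x m z≢x) z∉Θ) U₁⊑U₂)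
                   (≐⇒⊑ₑ λ y → sym (upd-comm Θ (just U₂) m z≢x y)))

,-mono : ∀ Γ x {A B} → A ⊑ B → (Γ , x ∶ A) ⊑ₑ (Γ , x ∶ B)
,-mono Γ x {A} {B} A⊑B =
  ⊑ₑ-trans (≐⇒⊑ₑ λ y → sym (upd-shadow Γ x nothing (just A) y))
    (⊑ₑ-trans (⊑ₑ-ext (upd-here Γ x nothing) A⊑B)
      (≐⇒⊑ₑ (upd-shadow Γ x nothing (just B))))

data _⊑ₘ_ : Maybe 𝕌 → Maybe 𝕌 → Set where
  nothing⊑ : nothing ⊑ₘ nothing
  just⊑    : ∀ {U V} → U ⊑ V → just U ⊑ₘ just V

⊑ₘ-refl : ∀ m → m ⊑ₘ m
⊑ₘ-refl nothing  = nothing⊑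
⊑ₘ-refl (just U) = just⊑ ⊑-id

⊑ₘ-trans : ∀ {a b c} → a ⊑ₘ b → b ⊑ₘ c → a ⊑ₘ c
⊑ₘ-trans nothing⊑   nothing⊑   = nothing⊑
⊑ₘ-trans (just⊑ p) (just⊑ q) = just⊑ (⊑-trans p q)

⊑ₑ-at : ∀ {Γ Δ} → Γ ⊑ₑ Δ → ∀ y → Γ y ⊑ₘ Δ y
⊑ₑ-at (⊑ₑ-refl Γ≈Δ) y = ≃ₘ⇒⊑ₘ (Γ≈Δ y)
  where
  ≃ₘ⇒⊑ₘ : ∀ {a b} → a ≃ₘ b → a ⊑ₘ b
  ≃ₘ⇒⊑ₘ nothing≃  = nothing⊑
  ≃ₘ⇒⊑ₘ (just≃ e) = just⊑ (⊑-refl e)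
⊑ₑ-at (⊑ₑ-trans p q) y = ⊑ₘ-trans (⊑ₑ-at p y) (⊑ₑ-at q y)
⊑ₑ-at (⊑ₑ-ext {Γ} {x} x∉Γ U₁⊑U₂) y with y ≟ x
... | yes _ = just⊑ U₁⊑U₂
... | no _  = ⊑ₘ-refl (Γ y)

⊑ₘ-nothing→ : ∀ {a b} → a ⊑ₘ b → a ≡ nothing → b ≡ nothing
⊑ₘ-nothing→ nothing⊑ refl = refl

⊑ₘ-nothing← : ∀ {a b} → a ⊑ₘ b → b ≡ nothing → a ≡ nothing
⊑ₘ-nothing← nothing⊑ refl = refl

⊑ₘ-just : ∀ {a b V} → a ⊑ₘ b → b ≃ₘ just V → ∃[ V' ] ((a ≡ just V') × (V' ⊑ V))
⊑ₘ-just (just⊑ p) (just≃ e) = _ , refl , ⊑-trans p (⊑-refl e)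

≈sing-here : ∀ {Γ x V} → Γ ≈ₑ [ x ∶ V ] → Γ x ≃ₘ just V
≈sing-here {Γ} {x} {V} Γ≈ = subst (Γ x ≃ₘ_) (upd-here ∅ x (just V)) (Γ≈ x)

≈sing-there : ∀ {Γ x V y} → Γ ≈ₑ [ x ∶ V ] → y ≢ x → Γ y ≡ nothing
≈sing-there {Γ} {x} {V} {y} Γ≈ y≢x =
  ≃ₘ-nothing (subst (Γ y ≃ₘ_) (upd-there ∅ x (just V) y≢x) (Γ≈ y))
  where
  ≃ₘ-nothing : ∀ {a} → a ≃ₘ nothing → a ≡ nothing
  ≃ₘ-nothing nothing≃ = refl

⊑ₑ-singleton : ∀ {Γ Δ x V} → Γ ⊑ₑ Δ → Δ ≈ₑ [ x ∶ V ] →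
               ∃[ V' ] ((Γ ≈ₑ [ x ∶ V' ]) × (V' ⊑ V))
⊑ₑ-singleton {Γ} {Δ} {x} Γ⊑Δ Δ≈ with ⊑ₘ-just (⊑ₑ-at Γ⊑Δ x) (≈sing-here Δ≈)
... | V' , Γx , V'⊑V = V' , Γ≈ , V'⊑V
  where
  Γ≈ : Γ ≈ₑ [ x ∶ V' ]
  Γ≈ y with y ≟ x
  ... | yes refl rewrite Γx = just≃ ≃-refl
  ... | no y≢x rewrite ⊑ₘ-nothing← (⊑ₑ-at Γ⊑Δ y) (≈sing-there Δ≈ y≢x) = nothing≃

⊑ₜ-inv : ∀ {Γ Γ' U U'} → ⟨ Γ ⊢ U ⟩ ⊑ₜ ⟨ Γ' ⊢ U' ⟩ → (U ⊑ U') × (Γ' ⊑ₑ Γ)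
⊑ₜ-inv (⊑ₜ-refl Γ≈Γ' U≃U') = ⊑-refl U≃U' , ⊑ₑ-refl (λ y → sym≃ₘ (Γ≈Γ' y))
  where
  sym≃ₘ : ∀ {a b} → a ≃ₘ b → b ≃ₘ a
  sym≃ₘ nothing≃  = nothing≃
  sym≃ₘ (just≃ e) = just≃ (≃-sym e)
⊑ₜ-inv (⊑ₜ-trans p q) =
  ⊑-trans (proj₁ (⊑ₜ-inv p)) (proj₁ (⊑ₜ-inv q)) , ⊑ₑ-trans (proj₂ (⊑ₜ-inv q)) (proj₂ (⊑ₜ-inv p))
⊑ₜ-inv (⊑ₜ-⟨⟩ U⊑U' Γ'⊑Γ) = U⊑U' , Γ'⊑Γ

subsume : ∀ {M Γ Γ' U U'} → M ∶⟨ Γ ⊢ U ⟩ → U ⊑ U' → Γ' ⊑ₑ Γ → M ∶⟨ Γ' ⊢ U' ⟩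
subsume D U⊑U' Γ'⊑Γ = ⊑r D (⊑ₜ-⟨⟩ U⊑U' Γ'⊑Γ)

-- A syntax-directed characterisation of ⊑

-- U ≤ᵁ U' : every component of U' lies above some component of U;
-- U ∋≤ T  : some component of U lies below T;
-- T ≤ᵀ T' : T and T' have the same shape, with ≤ᵁ contravariantly on
--            arguments and ≤ᵀ covariantly on results.
infix 4 _≤ᵁ_ _∋≤_ _≤ᵀ_
data _≤ᵁ_ : 𝕌 → 𝕌 → Set
data _∋≤_ : 𝕌 → 𝕋 → Set
data _≤ᵀ_ : 𝕋 → 𝕋 → Set

data _≤ᵁ_ where
  top   : ∀ {U} → U ≤ᵁ ω
  meet  : ∀ {U A B} → U ≤ᵁ A → U ≤ᵁ B → U ≤ᵁ A ⊓ B
  prime : ∀ {U T} → U ∋≤ T → U ≤ᵁ ⌜ T ⌝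

data _∋≤_ where
  inL : ∀ {A B T} → A ∋≤ T → A ⊓ B ∋≤ T
  inR : ∀ {A B T} → B ∋≤ T → A ⊓ B ∋≤ T
  at  : ∀ {T T'} → T ≤ᵀ T' → ⌜ T ⌝ ∋≤ T'

data _≤ᵀ_ where
  atom≤ : ∀ {a} → atom a ≤ᵀ atom a
  arr≤  : ∀ {V V' T T'} → V' ≤ᵁ V → T ≤ᵀ T' → V ⇒ T ≤ᵀ V' ⇒ T'

≤ᵁ-wkL : ∀ {U B U'} → U ≤ᵁ U' → U ⊓ B ≤ᵁ U'
≤ᵁ-wkL top        = top
≤ᵁ-wkL (meet p q) = meet (≤ᵁ-wkL p) (≤ᵁ-wkL q)
≤ᵁ-wkL (prime c)  = prime (inL c)

≤ᵁ-wkR : ∀ {U B U'} → U ≤ᵁ U' → B ⊓ U ≤ᵁ U'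
≤ᵁ-wkR top        = top
≤ᵁ-wkR (meet p q) = meet (≤ᵁ-wkR p) (≤ᵁ-wkR q)
≤ᵁ-wkR (prime c)  = prime (inR c)

≤ᵁ-⊓ : ∀ {A A' B B'} → A ≤ᵁ A' → B ≤ᵁ B' → A ⊓ B ≤ᵁ A' ⊓ B'
≤ᵁ-⊓ p q = meet (≤ᵁ-wkL p) (≤ᵁ-wkR q)

≤ᵁ-refl : ∀ U → U ≤ᵁ U
≤ᵀ-refl : ∀ T → T ≤ᵀ T
≤ᵁ-refl ω       = top
≤ᵁ-refl (A ⊓ B) = ≤ᵁ-⊓ (≤ᵁ-refl A) (≤ᵁ-refl B)
≤ᵁ-refl ⌜ T ⌝   = prime (at (≤ᵀ-refl T))
≤ᵀ-refl (atom a) = atom≤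
≤ᵀ-refl (V ⇒ T)  = arr≤ (≤ᵁ-refl V) (≤ᵀ-refl T)

≤ᵁ-trans : ∀ {U₁ U₂ U₃} → U₁ ≤ᵁ U₂ → U₂ ≤ᵁ U₃ → U₁ ≤ᵁ U₃
∋≤-transˡ : ∀ {U₁ U₂ T} → U₁ ≤ᵁ U₂ → U₂ ∋≤ T → U₁ ∋≤ T
∋≤-transʳ : ∀ {U T T'} → U ∋≤ T → T ≤ᵀ T' → U ∋≤ T'
≤ᵀ-trans : ∀ {T₁ T₂ T₃} → T₁ ≤ᵀ T₂ → T₂ ≤ᵀ T₃ → T₁ ≤ᵀ T₃
≤ᵁ-trans p top        = top
≤ᵁ-trans p (meet q r) = meet (≤ᵁ-trans p q) (≤ᵁ-trans p r)
≤ᵁ-trans p (prime c)  = prime (∋≤-transˡ p c)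
∋≤-transˡ (meet p q) (inL c) = ∋≤-transˡ p c
∋≤-transˡ (meet p q) (inR c) = ∋≤-transˡ q c
∋≤-transˡ (prime c)  (at t)  = ∋≤-transʳ c t
∋≤-transʳ (inL c) t = inL (∋≤-transʳ c t)
∋≤-transʳ (inR c) t = inR (∋≤-transʳ c t)
∋≤-transʳ (at t₀) t = at (≤ᵀ-trans t₀ t)
≤ᵀ-trans atom≤ atom≤ = atom≤
≤ᵀ-trans (arr≤ p q) (arr≤ p' q') = arr≤ (≤ᵁ-trans p' p) (≤ᵀ-trans q q')

≤ᵁ-⌜⌝ : ∀ {T T'} → ⌜ T ⌝ ≤ᵁ ⌜ T' ⌝ → T ≤ᵀ T'
≤ᵁ-⌜⌝ (prime (at t)) = t

≃⇒≤ᵁ : ∀ {U V} → U ≃ V → (U ≤ᵁ V) × (V ≤ᵁ U)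
≃⇒≤ᵁ {U} ≃-refl = ≤ᵁ-refl U , ≤ᵁ-refl U
≃⇒≤ᵁ (≃-sym e) = proj₂ (≃⇒≤ᵁ e) , proj₁ (≃⇒≤ᵁ e)
≃⇒≤ᵁ (≃-trans e f) =
  ≤ᵁ-trans (proj₁ (≃⇒≤ᵁ e)) (proj₁ (≃⇒≤ᵁ f)) , ≤ᵁ-trans (proj₂ (≃⇒≤ᵁ f)) (proj₂ (≃⇒≤ᵁ e))
≃⇒≤ᵁ (≃-comm {U} {V}) =
  meet (≤ᵁ-wkR (≤ᵁ-refl V)) (≤ᵁ-wkL (≤ᵁ-refl U)) , meet (≤ᵁ-wkR (≤ᵁ-refl U)) (≤ᵁ-wkL (≤ᵁ-refl V))
≃⇒≤ᵁ (≃-assoc {U} {V} {W}) =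
  meet (≤ᵁ-wkL (≤ᵁ-wkL (≤ᵁ-refl U))) (≤ᵁ-⊓ (≤ᵁ-wkR (≤ᵁ-refl V)) (≤ᵁ-refl W)) ,
  meet (≤ᵁ-⊓ (≤ᵁ-refl U) (≤ᵁ-wkL (≤ᵁ-refl V))) (≤ᵁ-wkR (≤ᵁ-wkR (≤ᵁ-refl W)))
≃⇒≤ᵁ (≃-idem {U}) = ≤ᵁ-wkL (≤ᵁ-refl U) , meet (≤ᵁ-refl U) (≤ᵁ-refl U)
≃⇒≤ᵁ (≃-unit {U}) = ≤ᵁ-wkR (≤ᵁ-refl U) , meet top (≤ᵁ-refl U)
≃⇒≤ᵁ (≃-⊓ e f) = ≤ᵁ-⊓ (proj₁ (≃⇒≤ᵁ e)) (proj₁ (≃⇒≤ᵁ f)) , ≤ᵁ-⊓ (proj₂ (≃⇒≤ᵁ e)) (proj₂ (≃⇒≤ᵁ f))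
≃⇒≤ᵁ (≃-⇒ e f) =
  prime (at (arr≤ (proj₂ (≃⇒≤ᵁ e)) (≤ᵁ-⌜⌝ (proj₁ (≃⇒≤ᵁ f))))) ,
  prime (at (arr≤ (proj₁ (≃⇒≤ᵁ e)) (≤ᵁ-⌜⌝ (proj₂ (≃⇒≤ᵁ f)))))

⊑⇒≤ᵁ : ∀ {U V} → U ⊑ V → U ≤ᵁ V
⊑⇒≤ᵁ (⊑-refl e)    = proj₁ (≃⇒≤ᵁ e)
⊑⇒≤ᵁ (⊑-trans p q) = ≤ᵁ-trans (⊑⇒≤ᵁ p) (⊑⇒≤ᵁ q)
⊑⇒≤ᵁ (⊑-⊓ₗ {U₁})   = ≤ᵁ-wkL (≤ᵁ-refl U₁)
⊑⇒≤ᵁ (⊑-⊓ p q)     = ≤ᵁ-⊓ (⊑⇒≤ᵁ p) (⊑⇒≤ᵁ q)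
⊑⇒≤ᵁ (⊑-⇒ p q)     = prime (at (arr≤ (⊑⇒≤ᵁ p) (≤ᵁ-⌜⌝ (⊑⇒≤ᵁ q))))

-- ω is the top type (ω ⊓ U = U and ω ⊓ U ⊑ ω).
⊑-ω : ∀ U → U ⊑ ω
⊑-ω U = ⊑-trans (⊑-refl (≃-sym ≃-unit)) ⊑-⊓ₗ

≤ᵁ⇒⊑ : ∀ {U V} → U ≤ᵁ V → U ⊑ V
∋≤⇒⊑ : ∀ {U T} → U ∋≤ T → U ⊑ ⌜ T ⌝
≤ᵀ⇒⊑ : ∀ {T T'} → T ≤ᵀ T' → ⌜ T ⌝ ⊑ ⌜ T' ⌝
≤ᵁ⇒⊑ {U} top   = ⊑-ω U
≤ᵁ⇒⊑ (meet p q) = ⊑-trans (⊑-refl (≃-sym ≃-idem)) (⊑-⊓ (≤ᵁ⇒⊑ p) (≤ᵁ⇒⊑ q))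
≤ᵁ⇒⊑ (prime c)  = ∋≤⇒⊑ c
∋≤⇒⊑ (inL c) = ⊑-trans ⊑-⊓ₗ (∋≤⇒⊑ c)
∋≤⇒⊑ (inR c) = ⊑-trans (⊑-refl ≃-comm) (⊑-trans ⊑-⊓ₗ (∋≤⇒⊑ c))
∋≤⇒⊑ (at t)  = ≤ᵀ⇒⊑ t
≤ᵀ⇒⊑ atom≤       = ⊑-id
≤ᵀ⇒⊑ (arr≤ p q) = ⊑-⇒ (≤ᵁ⇒⊑ p) (≤ᵀ⇒⊑ q)

-- Components and normal forms

infix 4 _∋_
data _∋_ : 𝕌 → 𝕋 → Set where
  inL : ∀ {A B T} → A ∋ T → A ⊓ B ∋ T
  inR : ∀ {A B T} → B ∋ T → A ⊓ B ∋ T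
  at  : ∀ {T} → ⌜ T ⌝ ∋ T

Every : (𝕋 → Set) → 𝕌 → Set
Every P U = ∀ {T} → U ∋ T → P T

every-⊓ : ∀ {P A B} → Every P A → Every P B → Every P (A ⊓ B)
every-⊓ pA pB (inL c) = pA c
every-⊓ pA pB (inR c) = pB c

component-below : ∀ {U U' T'} → U ≤ᵁ U' → U' ∋ T' → Σ 𝕋 λ T → (U ∋ T) × (T ≤ᵀ T')
component-below p c = split (lower p c)
  where
  lower : ∀ {U U' T'} → U ≤ᵁ U' → U' ∋ T' → U ∋≤ T'
  lower (meet p q) (inL c) = lower p c
  lower (meet p q) (inR c) = lower q c
  lower (prime c)  at      = c
  split : ∀ {U T'} → U ∋≤ T' → Σ 𝕋 λ T → (U ∋ T) × (T ≤ᵀ T')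
  split (inL c) with split c
  ... | T , m , t = T , inL m , t
  split (inR c) with split c
  ... | T , m , t = T , inR m , t
  split (at {T} t) = T , at , t

every-⊑ : ∀ {P U U'} → (∀ {T T'} → T ≤ᵀ T' → P T → P T') →
          U ⊑ U' → Every P U → Every P U'
every-⊑ P-up U⊑U' pU c with component-below (⊑⇒≤ᵁ U⊑U') c
... | T , m , t = P-up t (pU m)

components : 𝕌 → List 𝕋
components ω       = []
components (A ⊓ B) = components A ++ components B
components ⌜ T ⌝   = T ∷ []

⨅ˡ : List 𝕋 → 𝕌
⨅ˡ []      = ω
⨅ˡ (T ∷ L) = ⌜ T ⌝ ⊓ ⨅ˡ L

⨅ˡ-++ : ∀ L₁ L₂ → ⨅ˡ (L₁ ++ L₂) ≃ ⨅ˡ L₁ ⊓ ⨅ˡ L₂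
⨅ˡ-++ []       L₂ = ≃-sym ≃-unit
⨅ˡ-++ (T ∷ L₁) L₂ = ≃-trans (≃-⊓ ≃-refl (⨅ˡ-++ L₁ L₂)) (≃-sym ≃-assoc)

≃-components : ∀ U → U ≃ ⨅ˡ (components U)
≃-components ω       = ≃-refl
≃-components (A ⊓ B) =
  ≃-trans (≃-⊓ (≃-components A) (≃-components B)) (≃-sym (⨅ˡ-++ (components A) (components B)))
≃-components ⌜ T ⌝   = ≃-sym (≃-trans ≃-comm ≃-unit)

∈-components : ∀ U {T} → T ∈ components U → U ∋ T
∈-components (A ⊓ B) T∈ with ∈-++⁻ (components A) T∈
... | inj₁ T∈A = inL (∈-components A T∈A)
... | inj₂ T∈B = inR (∈-components B T∈B)
∈-components ⌜ T ⌝ (here refl) = at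

⨅ˡ-lookup : ∀ L → ⨅ˡ L ≡ ⨅ (λ i → ⌜ lookup L i ⌝)
⨅ˡ-lookup []      = refl
⨅ˡ-lookup (T ∷ L) = cong (⌜ T ⌝ ⊓_) (⨅ˡ-lookup L)

⨅-cong : ∀ {k} {f g : Fin k → 𝕌} → (∀ i → f i ≃ g i) → ⨅ f ≃ ⨅ g
⨅-cong {ℕ.zero}  f≃g = ≃-refl
⨅-cong {ℕ.suc k} f≃g = ≃-⊓ (f≃g Fin.zero) (⨅-cong (λ i → f≃g (Fin.suc i)))

ComponentForm : (𝕋 → Set) → 𝕌 → Set
ComponentForm P U =
  (U ≃ ω) ⊎
  (Σ ℕ λ k → (1 ≤ k) × Σ (Fin k → 𝕋) λ T → (U ≃ ⨅ (λ i → ⌜ T i ⌝)) × (∀ i → P (T i)))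

componentForm : ∀ {P U} → Every P U → ComponentForm P U
componentForm {P} {U} pU = go (components U) (≃-components U) (λ T∈ → pU (∈-components U T∈))
  where
  go : ∀ L → U ≃ ⨅ˡ L → (∀ {T} → T ∈ L → P T) → ComponentForm P U
  go []      U≃ pL = inj₁ U≃
  go (T ∷ L) U≃ pL = inj₂ (_ , s≤s z≤n , lookup (T ∷ L) ,
    ≃-trans U≃ (subst (⨅ˡ (T ∷ L) ≃_) (⨅ˡ-lookup (T ∷ L)) ≃-refl) , λ i → pL (∈-lookup i))

IsArrow : (𝕌 → 𝕋 → Set) → 𝕋 → Set
IsArrow Q T = Σ 𝕌 λ V → Σ 𝕋 λ T₀ → (T ≡ V ⇒ T₀) × Q V T₀

isArrow-up : ∀ {Q} → (∀ {V V' T T'} → V' ⊑ V → ⌜ T ⌝ ⊑ ⌜ T' ⌝ → Q V T → Q V' T') →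
             ∀ {T T'} → T ≤ᵀ T' → IsArrow Q T → IsArrow Q T'
isArrow-up Q-mono (arr≤ p q) (V , T₀ , refl , qVT₀) = _ , _ , refl , Q-mono (≤ᵁ⇒⊑ p) (≤ᵀ⇒⊑ q) qVT₀

ArrowForm : (𝕌 → 𝕋 → Set) → 𝕌 → Set
ArrowForm Q U =
  (U ≃ ω) ⊎
  (Σ ℕ λ k → (1 ≤ k) × Σ (Fin k → 𝕌) λ V → Σ (Fin k → 𝕋) λ T →
     (U ≃ ⨅ (λ i → ⌜ V i ⇒ T i ⌝)) × (∀ i → Q (V i) (T i)))

arrowForm : ∀ {Q U} → Every (IsArrow Q) U → ArrowForm Q U
arrowForm {Q} {U} pU with componentForm pU
... | inj₁ U≃ω = inj₁ U≃ω
... | inj₂ (k , 1≤k , T , U≃⨅T , arrows) = inj₂ (k , 1≤k , V , T₀ , U≃⨅arrows , Q-parts)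
  where
  V : Fin k → 𝕌
  V i = proj₁ (arrows i)
  T₀ : Fin k → 𝕋
  T₀ i = proj₁ (proj₂ (arrows i))
  Q-parts : ∀ i → Q (V i) (T₀ i)
  Q-parts i = proj₂ (proj₂ (proj₂ (arrows i)))
  T≃arrow : ∀ i → ⌜ T i ⌝ ≃ ⌜ V i ⇒ T₀ i ⌝
  T≃arrow i = subst (λ T' → ⌜ T i ⌝ ≃ ⌜ T' ⌝) (proj₁ (proj₂ (proj₂ (arrows i)))) ≃-refl
  U≃⨅arrows : U ≃ ⨅ (λ i → ⌜ V i ⇒ T₀ i ⌝)
  U≃⨅arrows = ≃-trans U≃⨅T (⨅-cong T≃arrow)

-- The domain of a derivable typing is the set of free variables

fv-lam⁺ : ∀ {x M y} → y ∈ fv M → y ≢ x → y ∈ fv (lam x M)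
fv-lam⁺ {x} y∈M y≢x = ∈-filter⁺ (λ z → ¬? (z ≟ x)) y∈M y≢x

fv-lam⁻ : ∀ {x M y} → y ∈ fv (lam x M) → (y ∈ fv M) × (y ≢ x)
fv-lam⁻ {x} {M} = ∈-filter⁻ (λ z → ¬? (z ≟ x)) {xs = fv M}

x∉fv-lam : ∀ {x M} → x ∉ fv (lam x M)
x∉fv-lam {x} {M} x∈ = proj₂ (fv-lam⁻ {x} {M} x∈) refl

∉fv⇒∉dom : ∀ {M Γ U y} → M ∶⟨ Γ ⊢ U ⟩ → y ∉ fv M → y ∉dom Γ
∉fv⇒∉dom (ax {x}) y∉ = upd-there ∅ x _ (λ y≡x → y∉ (here y≡x))
∉fv⇒∉dom (ω-r {M}) y∉ = envω-∉ M y∉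
∉fv⇒∉dom {y = y} (→i {Γ} {x} {U} {M = M} x∉Γ D) y∉ with y ≟ x
... | yes refl = x∉Γ
... | no y≢x   =
  trans (sym (upd-there Γ x (just U) y≢x)) (∉fv⇒∉dom D (λ y∈ → y∉ (fv-lam⁺ {x} {M} y∈ y≢x)))
∉fv⇒∉dom {y = y} (→'i {x = x} {M = M} x∉Γ D) y∉ with y ≟ x
... | yes refl = x∉Γ
... | no y≢x   = ∉fv⇒∉dom D (λ y∈ → y∉ (fv-lam⁺ {x} {M} y∈ y≢x))
∉fv⇒∉dom {y = y} (→e {Γ₁} {Γ₂} {M₁ = M₁} D₁ D₂) y∉ =
  trans (⊓ₑ-nothingˡ Γ₁ Γ₂ y (∉fv⇒∉dom D₁ (λ y∈ → y∉ (∈-++⁺ˡ y∈))))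
        (∉fv⇒∉dom D₂ (λ y∈ → y∉ (∈-++⁺ʳ (fv M₁) y∈)))
∉fv⇒∉dom (⊓i D₁ D₂) y∉ = ∉fv⇒∉dom D₁ y∉
∉fv⇒∉dom {y = y} (⊑r D s) y∉ = ⊑ₘ-nothing← (⊑ₑ-at (proj₂ (⊑ₜ-inv s)) y) (∉fv⇒∉dom D y∉)

∈fv⇒∈dom : ∀ {M Γ U y} → M ∶⟨ Γ ⊢ U ⟩ → y ∈ fv M → ¬ (y ∉dom Γ)
∈fv⇒∈dom (ax {x} {T}) (here refl) y∉ = ,-∈dom ∅ x ⌜ T ⌝ y∉
∈fv⇒∈dom (ω-r {M}) y∈ y∉ with trans (sym (envω-∈ M y∈)) y∉
... | ()
∈fv⇒∈dom (→i {Γ} {x} {U} {M = M} x∉Γ D) y∈ y∉ with fv-lam⁻ {x} {M} y∈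
... | y∈M , y≢x = ∈fv⇒∈dom D y∈M (trans (upd-there Γ x (just U) y≢x) y∉)
∈fv⇒∈dom (→'i {x = x} {M = M} x∉Γ D) y∈ y∉ = ∈fv⇒∈dom D (proj₁ (fv-lam⁻ {x} {M} y∈)) y∉
∈fv⇒∈dom {y = y} (→e {Γ₁} {Γ₂} {M₁ = M₁} D₁ D₂) y∈ y∉ with ∈-++⁻ (fv M₁) y∈
... | inj₁ y∈₁ = ∈fv⇒∈dom D₁ y∈₁ (proj₁ (⊓ₑ-nothing⁻ Γ₁ Γ₂ y y∉))
... | inj₂ y∈₂ = ∈fv⇒∈dom D₂ y∈₂ (proj₂ (⊓ₑ-nothing⁻ Γ₁ Γ₂ y y∉))
∈fv⇒∈dom (⊓i D₁ D₂) y∈ y∉ = ∈fv⇒∈dom D₁ y∈ y∉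
∈fv⇒∈dom {y = y} (⊑r D s) y∈ y∉ = ∈fv⇒∈dom D y∈ (⊑ₘ-nothing→ (⊑ₑ-at (proj₂ (⊑ₜ-inv s)) y) y∉)

≈sing-unique : ∀ {Γ x V₁ V₂} → Γ ≈ₑ [ x ∶ V₁ ] → Γ ≈ₑ [ x ∶ V₂ ] → V₁ ≃ V₂
≈sing-unique Γ≈₁ Γ≈₂ = unique (≈sing-here Γ≈₁) (≈sing-here Γ≈₂)
  where
  unique : ∀ {a V₁ V₂} → a ≃ₘ just V₁ → a ≃ₘ just V₂ → V₁ ≃ V₂
  unique (just≃ e₁) (just≃ e₂) = ≃-trans (≃-sym e₁) e₂

var-generation : ∀ {x Γ U} → var x ∶⟨ Γ ⊢ U ⟩ → ∃[ V ] ((Γ ≈ₑ [ x ∶ V ]) × (V ⊑ U))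
var-generation (ax {x} {T}) = ⌜ T ⌝ , (λ y → ≃ₘ-refl ([ x ∶ ⌜ T ⌝ ] y)) , ⊑-id
var-generation {x} ω-r = ω , envω-var , ⊑-id
  where
  envω-var : envω (var x) ≈ₑ [ x ∶ ω ]
  envω-var y with y ≟ x
  ... | yes _ = just≃ ≃-refl
  ... | no _  = nothing≃
var-generation (⊓i D₁ D₂) with var-generation D₁ | var-generation D₂
... | V₁ , Γ≈₁ , V₁⊑U₁ | V₂ , Γ≈₂ , V₂⊑U₂ =
  V₁ , Γ≈₁ , ⊑-trans (⊑-refl (≃-sym ≃-idem))
                     (⊑-⊓ V₁⊑U₁ (⊑-trans (⊑-refl (≈sing-unique Γ≈₁ Γ≈₂)) V₂⊑U₂))
var-generation (⊑r D s) with var-generation D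
... | V , Δ≈ , V⊑U with ⊑ₑ-singleton (proj₂ (⊑ₜ-inv s)) Δ≈
... | V' , Γ≈ , V'⊑V = V' , Γ≈ , ⊑-trans V'⊑V (⊑-trans V⊑U (proj₁ (⊑ₜ-inv s)))

split-app-env : ∀ {Γ Δ₁ Δ₂ x U W} → x ∉dom Γ → x ∉dom Δ₁ → Δ₂ ≈ₑ [ x ∶ W ] →
                (Γ , x ∶ U) ⊑ₑ (Δ₁ ⊓ₑ Δ₂) → (Γ ⊑ₑ Δ₁) × (U ⊑ W)
split-app-env {Γ} {Δ₁} {Δ₂} {x} {U} {W} x∉Γ x∉Δ₁ Δ₂≈ Γx⊑Δ = Γ⊑Δ₁ , U⊑W
  where
  at-x : just U ⊑ₘ Δ₂ x
  at-x = subst₂ _⊑ₘ_ (upd-here Γ x (just U)) (⊓ₑ-nothingˡ Δ₁ Δ₂ x x∉Δ₁) (⊑ₑ-at Γx⊑Δ x)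
  U⊑W : U ⊑ W
  U⊑W with ⊑ₘ-just at-x (≈sing-here Δ₂≈)
  ... | _ , refl , U⊑W = U⊑W
  drop-x : (Γ , x ∶ U) [ x ↦ nothing ] ≐ Γ
  drop-x y = trans (upd-shadow Γ x (just U) nothing y) (upd-id Γ x x∉Γ y)
  drop-x' : (Δ₁ ⊓ₑ Δ₂) [ x ↦ nothing ] ≐ Δ₁
  drop-x' y with y ≟ x
  ... | yes refl = sym x∉Δ₁
  ... | no y≢x   = ⊓ₑ-nothingʳ Δ₁ Δ₂ y (≈sing-there Δ₂≈ y≢x)
  Γ⊑Δ₁ : Γ ⊑ₑ Δ₁
  Γ⊑Δ₁ = ⊑ₑ-trans (≐⇒⊑ₑ λ y → sym (drop-x y))
           (⊑ₑ-trans (upd-mono x nothing Γx⊑Δ) (≐⇒⊑ₑ drop-x'))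

app-components : ∀ {M x Γ Δ U V} → x ∉ fv M → x ∉dom Γ → (Γ , x ∶ U) ⊑ₑ Δ →
                 app M (var x) ∶⟨ Δ ⊢ V ⟩ → Every (λ T → M ∶⟨ Γ ⊢ ⌜ U ⇒ T ⌝ ⟩) V
app-components x∉M x∉Γ Γx⊑Δ ω-r = λ ()
app-components x∉M x∉Γ Γx⊑Δ (→e D₁ D₂) at with var-generation D₂
... | W , Δ₂≈ , W⊑U' with split-app-env x∉Γ (∉fv⇒∉dom D₁ x∉M) Δ₂≈ Γx⊑Δ
... | Γ⊑Δ₁ , U⊑W = subsume D₁ (⊑-⇒ (⊑-trans U⊑W W⊑U') ⊑-id) Γ⊑Δ₁
app-components x∉M x∉Γ Γx⊑Δ (⊓i D₁ D₂) =
  every-⊓ (app-components x∉M x∉Γ Γx⊑Δ D₁) (app-components x∉M x∉Γ Γx⊑Δ D₂)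
app-components x∉M x∉Γ Γx⊑Δ (⊑r D s) =
  every-⊑ (λ t D' → subsume D' (⊑-⇒ ⊑-id (≤ᵀ⇒⊑ t)) ⊑ₑ-id) (proj₁ (⊑ₜ-inv s))
          (app-components x∉M x∉Γ (⊑ₑ-trans Γx⊑Δ (proj₂ (⊑ₜ-inv s))) D)

lam-∈-components : ∀ {x M Γ Δ U} → x ∈ fv M → Γ ⊑ₑ Δ → lam x M ∶⟨ Δ ⊢ U ⟩ →
                   Every (IsArrow (λ V T → M ∶⟨ Γ , x ∶ V ⊢ ⌜ T ⌝ ⟩)) U
lam-∈-components x∈M Γ⊑Δ ω-r = λ ()
lam-∈-components {x} x∈M Γ⊑Δ (→i {U = V} x∉Δ D) at =
  V , _ , refl , subsume D ⊑-id (upd-mono x (just V) Γ⊑Δ)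
lam-∈-components x∈M Γ⊑Δ (→'i x∉Δ D) = ⊥-elim (∈fv⇒∈dom D x∈M x∉Δ)
lam-∈-components x∈M Γ⊑Δ (⊓i D₁ D₂) =
  every-⊓ (lam-∈-components x∈M Γ⊑Δ D₁) (lam-∈-components x∈M Γ⊑Δ D₂)
lam-∈-components {x} {Γ = Γ} x∈M Γ⊑Δ (⊑r D s) =
  every-⊑ (isArrow-up λ V'⊑V T⊑T' D' → subsume D' T⊑T' (,-mono Γ x V'⊑V)) (proj₁ (⊑ₜ-inv s))
          (lam-∈-components x∈M (⊑ₑ-trans Γ⊑Δ (proj₂ (⊑ₜ-inv s))) D)

lam-∉-components : ∀ {x M Γ Δ U} → x ∉ fv M → Γ ⊑ₑ Δ → lam x M ∶⟨ Δ ⊢ U ⟩ →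
                   Every (IsArrow (λ V T → M ∶⟨ Γ ⊢ ⌜ T ⌝ ⟩)) U
lam-∉-components x∉M Γ⊑Δ ω-r = λ ()
lam-∉-components {x} x∉M Γ⊑Δ (→i {Δ} {U = V} x∉Δ D) =
  ⊥-elim (,-∈dom Δ x V (∉fv⇒∉dom D x∉M))
lam-∉-components x∉M Γ⊑Δ (→'i x∉Δ D) at = ω , _ , refl , subsume D ⊑-id Γ⊑Δ
lam-∉-components x∉M Γ⊑Δ (⊓i D₁ D₂) =
  every-⊓ (lam-∉-components x∉M Γ⊑Δ D₁) (lam-∉-components x∉M Γ⊑Δ D₂)
lam-∉-components x∉M Γ⊑Δ (⊑r D s) =
  every-⊑ (isArrow-up λ _ T⊑T' D' → subsume D' T⊑T' ⊑ₑ-id) (proj₁ (⊑ₜ-inv s))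
          (lam-∉-components x∉M (⊑ₑ-trans Γ⊑Δ (proj₂ (⊑ₜ-inv s))) D)

arrowForm-with : ∀ {S : Set} {Q U} → S → ArrowForm Q U →
  (U ≃ ω) ⊎
  (Σ ℕ λ k → (1 ≤ k) × Σ (Fin k → 𝕌) λ V → Σ (Fin k → 𝕋) λ T →
     (U ≃ ⨅ (λ i → ⌜ V i ⇒ T i ⌝)) × S × (∀ i → Q (V i) (T i)))
arrowForm-with s (inj₁ U≃ω) = inj₁ U≃ω
arrowForm-with s (inj₂ (k , 1≤k , V , T , U≃ , q)) = inj₂ (k , 1≤k , V , T , U≃ , s , q)

lemma3p1 :
      (∀ {x Γ U} → var x ∶⟨ Γ ⊢ U ⟩ →
         ∃[ V ] ((Γ ≈ₑ [ x ∶ V ]) × (V ⊑ U)))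
    × (∀ {M x Γ U V} → x ∉dom Γ → app M (var x) ∶⟨ Γ , x ∶ U ⊢ V ⟩ → x ∉ fv M →
         (V ≃ ω) ⊎
         (Σ ℕ λ k → (1 ≤ k) × Σ (Fin k → 𝕋) λ T →
            (V ≃ ⨅ (λ i → ⌜ T i ⌝)) × (∀ i → M ∶⟨ Γ ⊢ ⌜ U ⇒ T i ⌝ ⟩)))
    × (∀ {x M Γ U} → lam x M ∶⟨ Γ ⊢ U ⟩ → x ∈ fv M →
         (U ≃ ω) ⊎
         (Σ ℕ λ k → (1 ≤ k) × Σ (Fin k → 𝕌) λ V → Σ (Fin k → 𝕋) λ T →
            (U ≃ ⨅ (λ i → ⌜ V i ⇒ T i ⌝)) × (x ∉dom Γ)
            × (∀ i → M ∶⟨ Γ , x ∶ V i ⊢ ⌜ T i ⌝ ⟩)))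
    × (∀ {x M Γ U} → lam x M ∶⟨ Γ ⊢ U ⟩ → x ∉ fv M →
         (U ≃ ω) ⊎
         (Σ ℕ λ k → (1 ≤ k) × Σ (Fin k → 𝕌) λ V → Σ (Fin k → 𝕋) λ T →
            (U ≃ ⨅ (λ i → ⌜ V i ⇒ T i ⌝)) × (∀ i → M ∶⟨ Γ ⊢ ⌜ T i ⌝ ⟩)))
lemma3p1 =
    var-generation
  , (λ x∉Γ D x∉M → componentForm (app-components x∉M x∉Γ ⊑ₑ-id D))
  , (λ {x} {M} {Γ} D x∈M →
       arrowForm-with {Q = λ V T → M ∶⟨ Γ , x ∶ V ⊢ ⌜ T ⌝ ⟩}
         (∉fv⇒∉dom D (x∉fv-lam {x} {M})) (arrowForm (lam-∈-components x∈M ⊑ₑ-id D)))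
  , (λ D x∉M → arrowForm (lam-∉-components x∉M ⊑ₑ-id D))
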